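{- Let $G$ be a finite tree of order $n\geq3$ with a proper edge coloring $\kappa:E(G)\to[k]$. If $\mathfrak{G}_\kappa$ is a generalized toggle group, then $\mathfrak{G}_\kappa$ is primitive.
   Context: A proper edge coloring of $G$ on $k$ colors is a surjective map $\kappa:E(G)\to[k]$ such that edges sharing a vertex receive different colors. For $a\in[k]$, $\tau_a\in S_{V(G)}$ is the product of the transpositions $(i,j)$ over all edges $\{i,j\}$ colored $a$, and the coloring group $\mathfrak{G}_\kappa\le S_{V(G)}$ is the subgroup generated by $\tau_1,\dots,\tau_k$. Generalized toggle groups: for a finite set $E$ and $L\subseteq 2^E$, the toggle $t_e$ ($e\in E$) is the permutation of $L$ with $t_e(X)=X\cup\{e\}$ if $e\notin X$ and $X\cup\{e\}\in L$, $t_e(X)=X\setminus\{e\}$ if $e\in X$ and $X\setminus\{e\}\in L$, and $t_e(X)=X$ otherwise. "$\mathfrak{G}_\kappa$ is a generalized toggle group" means that the edge-colored graph $(G,\kappa)$ arises from toggles in this way: there exist a finite set $E$, a subset $L\subseteq 2^E$, a bijection $\varphi:V(G)\to L$ and an injective map $c:[k]\to E$ such that, for all distinct $u,v\in V(G)$ and $a\in[k]$, $\{u,v\}$ is an edge colored $a$ if and only if $\varphi(u)$ and $\varphi(v)$ have symmetric difference $\{c(a)\}$, and every $e\in E$ with $t_e\neq\mathrm{id}$ lies in the image of $c$ (so that $\tau_a$ corresponds to the toggle $t_{c(a)}$ and $\mathfrak{G}_\kappa$ corresponds to the toggle group generated by all toggles). A permutation group on $X$ is imprimitive if it fixes a set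 partition of $X$ that is neither the one-block partition nor the partition into singletons; otherwise it is primitive. -}

module Defs where

open import Data.Nat using (ℕ; suc; _≤_; _+_)
open import Data.Fin using (Fin; zero; suc; inject₁; fromℕ)
open import Data.Fin.Properties using (any?) renaming (_≟_ to _≟ᶠ_)
open import Data.Fin.Subset using (Subset; ⁅_⁆)
open import Data.Maybe using (Maybe; just; nothing)
open import Data.Maybe.Properties using (≡-dec)
open import Data.Vec using (zipWith; _[_]%=_)
open import Data.Bool using (_xor_; not)
open import Data.Product using (Σ; ∃; _×_; _,_)
open import Data.Empty using (⊥)
open import Function using (_∘_; id)
open import Function.Definitions using (Injective)
open import Relation.Nullary using (¬_; Dec; yes; no)
open import Relation.Binary using (IsEquivalence)
open import Relation.Binary.PropositionalEquality using (_≡_; _≢_)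
open import Level using (0ℓ)

-- An edge-colored simple graph on vertex set Fin n with colors Fin k is
-- encoded by  col : Fin n → Fin n → Maybe (Fin k):
--   col u v ≡ just a   means  {u,v} is an edge with color a,
--   col u v ≡ nothing  means  {u,v} is not an edge.

ColoredGraph : ℕ → ℕ → Set
ColoredGraph n k = Fin n → Fin n → Maybe (Fin k)

module _ {n k : ℕ} (col : ColoredGraph n k) where

  Adj : Fin n → Fin n → Set
  Adj u v = ∃ λ a → col u v ≡ just a

  record IsProperEdgeColoring : Set where
    field
      loopless  : ∀ u → col u u ≡ nothing
      symmetric : ∀ u v → col u v ≡ col v u
      proper    : ∀ u v w a → col u v ≡ just a → col u w ≡ just a → v ≡ w
      surjective : ∀ a → ∃ λ u → ∃ λ v → col u v ≡ just a

  data Walk : Fin n → Fin n → Set where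
    [] : ∀ {u} → Walk u u
    _∷_ : ∀ {u w v} → Adj u w → Walk w v → Walk u v

  Connected : Set
  Connected = ∀ u v → Walk u v

  -- a cycle of length m+3: distinct vertices f 0, …, f (m+2), consecutive
  -- ones adjacent, and f (m+2) adjacent to f 0
  record Cycle (m : ℕ) : Set where
    field
      f        : Fin (suc (suc (suc m))) → Fin n
      distinct : Injective _≡_ _≡_ f
      step     : ∀ (i : Fin (suc (suc m))) → Adj (f (inject₁ i)) (f (suc i))
      close    : Adj (f (fromℕ (suc (suc m)))) (f zero)

  Acyclic : Set
  Acyclic = ∀ m → ¬ Cycle m

  IsTree : Set
  IsTree = Connected × Acyclic

  -- τ_a : product of the transpositions (u v) over the edges colored a.
  -- (For a proper coloring these transpositions are disjoint, so τ_a v is the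
  -- other endpoint of the a-colored edge at v, or v if there is none.)
  τ : Fin k → Fin n → Fin n
  τ a v with any? (λ u → ≡-dec _≟ᶠ_ (col v u) (just a))
  ... | yes (u , _) = u
  ... | no _ = v

  -- the coloring group 𝔊_κ = ⟨τ_1,…,τ_k⟩ as a set of maps Fin n → Fin n
  -- (each τ_a is an involution, so the generated subgroup is the set of
  -- finite products of generators)
  data InColoringGroup : (Fin n → Fin n) → Set where
    gid  : InColoringGroup id
    gmul : ∀ a {g} → InColoringGroup g → InColoringGroup (τ a ∘ g)

-- Primitivity.  A set partition of Fin n is given by its equivalence
-- relation R (x R y iff x,y in the same block).

module _ {n : ℕ} (P : (Fin n → Fin n) → Set) where

  FixesPartition : (Fin n → Fin n → Set) → Set
  FixesPartition R = ∀ g → P g → ∀ x y → R x y → R (g x) (g y)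

  NontrivialPartition : (Fin n → Fin n → Set) → Set
  NontrivialPartition R =
    (∃ λ x → ∃ λ y → x ≢ y × R x y) × (∃ λ x → ∃ λ y → ¬ R x y)

  IsImprimitive : Set₁
  IsImprimitive = Σ (Fin n → Fin n → Set) λ R →
    IsEquivalence R × FixesPartition R × NontrivialPartition R

  IsPrimitive : Set₁
  IsPrimitive = ¬ IsImprimitive

-- Generalized toggles.  E = Fin m, subsets of E are Subset m.

_△_ : ∀ {m} → Subset m → Subset m → Subset m
X △ Y = zipWith _xor_ X Y

flipAt : ∀ {m} → Fin m → Subset m → Subset m
flipAt e X = X [ e ]%= not

toggle : ∀ {m} (L : Subset m → Set) → (∀ X → Dec (L X)) →
         Fin m → Subset m → Subset m
toggle L L? e X with L? (flipAt e X)
... | yes _ = flipAt e X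
... | no _  = X

ToggleNontrivial : ∀ {m} (L : Subset m → Set) → (∀ X → Dec (L X)) →
                   Fin m → Set
ToggleNontrivial L L? e = ∃ λ X → L X × toggle L L? e X ≢ X

-- (G, κ) arises from toggles: E = Fin m, L ⊆ 2^E, bijection φ : V → L,
-- injective c : [k] → E, with edges colored a ⇔ symmetric difference {c a},
-- and every e with t_e ≠ id in the image of c.
record ToggleRealization {n k : ℕ} (col : ColoredGraph n k) (m : ℕ) : Set₁ where
  field
    L        : Subset m → Set
    L?       : ∀ X → Dec (L X)
    φ        : Fin n → Subset m
    φ-into   : ∀ v → L (φ v)
    φ-inj    : Injective _≡_ _≡_ φ
    φ-onto   : ∀ X → L X → ∃ λ v → φ v ≡ X
    c        : Fin k → Fin m
    c-inj    : Injective _≡_ _≡_ c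
    edges⇒   : ∀ u v a → u ≢ v → col u v ≡ just a → φ u △ φ v ≡ ⁅ c a ⁆
    edges⇐   : ∀ u v a → u ≢ v → φ u △ φ v ≡ ⁅ c a ⁆ → col u v ≡ just a
    toggles  : ∀ e → ToggleNontrivial L L? e → ∃ λ a → c a ≡ e

IsGeneralizedToggleGroup : ∀ {n k} → ColoredGraph n k → Set₁
IsGeneralizedToggleGroup col = Σ ℕ λ m → ToggleRealization col m

{-# OPTIONS --safe #-}
-- Let R be a nontrivial 𝔊_κ-invariant equivalence. In a toggle-realised graph two edges
-- of colours a ≠ b at a vertex v span a square, so in a tree the a-neighbour of v has no
-- b-edge; hence τ_b carries a relation between adjacent u and v onto every further edge
-- at v, and R would be the one-block partition. Otherwise take R-related x ≠ y joined by
-- a shortest possible walk, of length d ≥ 2 with colours a₁ … a_d, and apply the periodic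
-- word τ_{a₁}, τ_{a₂}, … to the pair (x, y). Minimality forces every letter to move the
-- second vertex too, so both vertices follow edges with the same toggles and φ x △ φ y is
-- preserved; after d letters the first vertex is at y and the second is back at x.
-- Minimality again excludes repeated vertices, so the 2d vertices visited form a cycle.
module Submission where

open import Defs
open import Data.Nat using (ℕ; zero; suc; _+_; _∸_; _≤_; _<_; z≤n; s≤s; z<s; _≤?_; _%_)
open import Data.Nat.Properties
open import Data.Nat.DivMod using (m%n<n; [m+n]%n≡m%n; m<n⇒m%n≡m)
open import Data.Nat.Induction using (<-rec)
open import Data.Fin using (Fin; toℕ) renaming (zero to fzero; suc to fsuc)
open import Data.Fin.Properties using (any?; toℕ-injective; toℕ-inject₁; toℕ-fromℕ; toℕ<n) renaming (_≟_ to _≟ᶠ_)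
open import Data.Fin.Subset using (Subset; ⁅_⁆) renaming (⊥ to ∅)
open import Data.Vec using (_∷_; []; lookup)
open import Data.Vec.Properties using (zipWith-comm; zipWith-assoc; zipWith-identityˡ)
open import Data.Vec.Relation.Unary.Unique.Propositional using (Unique)
open import Data.Vec.Relation.Unary.Unique.Propositional.Properties using (lookup-injective)
open import Data.Vec.Relation.Unary.All using ([]; _∷_)
open import Data.Vec.Relation.Unary.AllPairs using ([]; _∷_)
open import Data.Bool.Properties using (xor-comm; xor-assoc; xor-same; xor-identityˡ)
open import Data.Maybe using (just)
open import Data.Maybe.Properties using (≡-dec; just-injective)
open import Data.Product using (Σ; _×_; _,_; proj₁; proj₂; uncurry)
open import Data.Sum using (_⊎_; inj₁; inj₂)
open import Data.Empty using (⊥-elim)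
open import Function using (_∘_; id)
open import Relation.Nullary using (¬_; yes; no)
open import Relation.Binary using (IsEquivalence; tri<; tri≈; tri>)
open import Relation.Binary.PropositionalEquality

△-self : ∀ {m} (X : Subset m) → X △ X ≡ ∅
△-self []      = refl
△-self (x ∷ X) = cong₂ _∷_ (xor-same x) (△-self X)

module _ {m : ℕ} where

  △-comm : (X Y : Subset m) → X △ Y ≡ Y △ X
  △-comm = zipWith-comm xor-comm

  △-assoc : (X Y Z : Subset m) → (X △ Y) △ Z ≡ X △ (Y △ Z)
  △-assoc = zipWith-assoc xor-assoc

  X△[X△Y]≡Y : (X Y : Subset m) → X △ (X △ Y) ≡ Y
  X△[X△Y]≡Y X Y = begin
    X △ (X △ Y)  ≡⟨ △-assoc X X Y ⟨
    (X △ X) △ Y  ≡⟨ cong (_△ Y) (△-self X) ⟩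
    ∅ △ Y        ≡⟨ zipWith-identityˡ xor-identityˡ Y ⟩
    Y            ∎
    where open ≡-Reasoning

  △-cancelˡ : (X : Subset m) {Y Z : Subset m} → X △ Y ≡ X △ Z → Y ≡ Z
  △-cancelˡ X {Y} {Z} eq = begin
    Y            ≡⟨ X△[X△Y]≡Y X Y ⟨
    X △ (X △ Y)  ≡⟨ cong (X △_) eq ⟩
    X △ (X △ Z)  ≡⟨ X△[X△Y]≡Y X Z ⟩
    Z            ∎
    where open ≡-Reasoning

  △-shift : {X X′ Y Y′ E : Subset m} → X △ X′ ≡ E → Y △ Y′ ≡ E → X′ △ Y′ ≡ X △ Y
  △-shift {X} {X′} {Y} {Y′} {E} XX′ YY′ = begin
    X′ △ Y′              ≡⟨ cong₂ _△_ (translate XX′) (translate YY′) ⟨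
    (X △ E) △ (Y △ E)    ≡⟨ △-assoc X E (Y △ E) ⟩
    X △ (E △ (Y △ E))    ≡⟨ cong (λ Z → X △ (E △ Z)) (△-comm Y E) ⟩
    X △ (E △ (E △ Y))    ≡⟨ cong (X △_) (X△[X△Y]≡Y E Y) ⟩
    X △ Y                ∎
    where
    open ≡-Reasoning
    translate : {Z Z′ : Subset m} → Z △ Z′ ≡ E → Z △ E ≡ Z′
    translate {Z} {Z′} ZZ′ = trans (cong (Z △_) (sym ZZ′)) (X△[X△Y]≡Y Z Z′)

module _ {n k : ℕ} {col : ColoredGraph n k} (pec : IsProperEdgeColoring col) where
  open IsProperEdgeColoring pec

  Adj⇒≢ : ∀ {u v} → Adj col u v → u ≢ v
  Adj⇒≢ {u} (a , uu) refl with trans (sym (loopless u)) uu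
  ... | ()

  colour-unique : ∀ {u v a b} → col u v ≡ just a → col u v ≡ just b → a ≡ b
  colour-unique ua ub = just-injective (trans (sym ua) ub)

  τ-edge : ∀ {a v u} → col v u ≡ just a → τ col a v ≡ u
  τ-edge {a} {v} {u} vu with any? (λ u → ≡-dec _≟ᶠ_ (col v u) (just a))
  ... | yes (u′ , vu′) = proper v u′ u a vu′ vu
  ... | no ∄u          = ⊥-elim (∄u (u , vu))

  τ-cases : ∀ a v → col v (τ col a v) ≡ just a ⊎ τ col a v ≡ v
  τ-cases a v with any? (λ u → ≡-dec _≟ᶠ_ (col v u) (just a))
  ... | yes (_ , vu) = inj₁ vu
  ... | no _         = inj₂ refl

  τ-involutive : ∀ a v → τ col a (τ col a v) ≡ v
  τ-involutive a v with τ-cases a v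
  ... | inj₁ moved = τ-edge (trans (symmetric _ v) moved)
  ... | inj₂ fixed = trans (cong (τ col a) fixed) fixed

  τ-injective : ∀ a {u v} → τ col a u ≡ τ col a v → u ≡ v
  τ-injective a {u} {v} eq =
    trans (sym (τ-involutive a u)) (trans (cong (τ col a) eq) (τ-involutive a v))

  InColoringGroup⇒injective : ∀ {g} → InColoringGroup col g → ∀ {u v} → g u ≡ g v → u ≡ v
  InColoringGroup⇒injective gid        eq = eq
  InColoringGroup⇒injective (gmul a g) eq = InColoringGroup⇒injective g (τ-injective a eq)

module _ {n k : ℕ} (col : ColoredGraph n k) where

  Chain : (ℕ → Fin n) → ℕ → Set
  Chain w N = ∀ j → j < N → Adj col (w j) (w (suc j))

  walk⇒chain : ∀ {u v} → Walk col u v →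
               Σ ℕ λ N → Σ (ℕ → Fin n) λ w → w 0 ≡ u × w N ≡ v × Chain w N
  walk⇒chain {u} [] = 0 , (λ _ → u) , refl , refl , λ _ ()
  walk⇒chain {u} (uw ∷ q) with walk⇒chain q
  ... | N , w , refl , wN , chain =
    suc N , (λ { zero → u ; (suc j) → w j }) , refl , wN ,
    λ { zero _ → uw ; (suc j) (s≤s j<N) → chain j j<N }

  chain-segment : ∀ {w t s} → Chain w t → s ≤ t → Chain (λ j → w (j + s)) (t ∸ s)
  chain-segment {t = t} {s} chain s≤t j j<t∸s =
    chain (j + s) (subst (j + s <_) (m∸n+n≡m s≤t) (+-monoˡ-< s j<t∸s))

  square⇒cycle : ∀ {u v w t} → Unique (u ∷ v ∷ w ∷ t ∷ []) →
                 Adj col u v → Adj col v w → Adj col w t → Adj col t u → Cycle col 1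
  square⇒cycle uniq uv vw wt tu = record
    { f        = lookup (_ ∷ _ ∷ _ ∷ _ ∷ [])
    ; distinct = λ {i} {j} → lookup-injective uniq i j
    ; step     = λ { fzero → uv ; (fsuc fzero) → vw ; (fsuc (fsuc fzero)) → wt }
    ; close    = tu
    }

  closed-chain⇒cycle : (w : ℕ → Fin n) {N : ℕ} → 3 ≤ N → Chain w N → w N ≡ w 0 →
                       (∀ {s t} → s < t → t < N → w s ≢ w t) → Σ ℕ (Cycle col)
  closed-chain⇒cycle w (s≤s (s≤s (s≤s {n = m} _))) chain closed injective = m , record
    { f        = w ∘ toℕ
    ; distinct = distinct
    ; step     = λ i → subst (λ j → Adj col (w j) (w (suc (toℕ i))))
                             (sym (toℕ-inject₁ i)) (chain (toℕ i) (m<n⇒m<1+n (toℕ<n i)))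
    ; close    = subst₂ (Adj col) (cong w (sym (toℕ-fromℕ (suc (suc m))))) closed
                        (chain (suc (suc m)) ≤-refl)
    }
    where
    distinct : ∀ {i j} → w (toℕ i) ≡ w (toℕ j) → i ≡ j
    distinct {i} {j} eq with <-cmp (toℕ i) (toℕ j)
    ... | tri< i<j _ _ = ⊥-elim (injective i<j (toℕ<n j) eq)
    ... | tri≈ _ i≡j _ = toℕ-injective i≡j
    ... | tri> _ _ j<i = ⊥-elim (injective j<i (toℕ<n i) (sym eq))

module Toggles {n k m : ℕ} {col : ColoredGraph n k}
               (pec : IsProperEdgeColoring col) (tr : ToggleRealization col m) where
  open IsProperEdgeColoring pec
  open ToggleRealization tr

  φ-edge : ∀ {u v a} → col u v ≡ just a → φ u △ φ v ≡ ⁅ c a ⁆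
  φ-edge {u} {v} {a} uv = edges⇒ u v a (Adj⇒≢ pec (a , uv)) uv

  square-completion : ∀ {u v w t a b} → col u v ≡ just a → col u t ≡ just b →
                      col v w ≡ just b → t ≢ w → col t w ≡ just a
  square-completion {w = w} {t} {a} uv ut vw t≢w =
    edges⇐ t w a t≢w (trans (△-shift (φ-edge ut) (φ-edge vw)) (φ-edge uv))

  -- Otherwise the b-neighbour t of u would close the square u v w t.
  τ-fixes-neighbour : Acyclic col → ∀ {v u w a b} → col v u ≡ just a → col v w ≡ just b →
                      a ≢ b → τ col b u ≡ u
  τ-fixes-neighbour acyclic {v} {u} {w} {a} {b} vu vw a≢b with τ-cases pec b u
  ... | inj₂ fixed = fixed
  ... | inj₁ ut    = ⊥-elim (acyclic 1 (square⇒cycle col uniq (a , uv) (b , vw) (a , wt) (b , tu)))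
    where
    t : Fin n
    t = τ col b u
    uv : col u v ≡ just a
    uv = trans (symmetric u v) vu
    tu : col t u ≡ just b
    tu = trans (symmetric t u) ut
    t≢w : t ≢ w
    t≢w t≡w = Adj⇒≢ pec (a , uv) (proper w u v b (subst (λ z → col z u ≡ just b) t≡w tu)
                                                  (trans (symmetric w v) vw))
    wt : col w t ≡ just a
    wt = trans (symmetric w t) (square-completion uv ut vw t≢w)
    uniq : Unique (u ∷ v ∷ w ∷ t ∷ [])
    uniq = (Adj⇒≢ pec (a , uv)
             ∷ (λ u≡w → a≢b (colour-unique pec vu (subst (λ z → col v z ≡ just b) (sym u≡w) vw)))
             ∷ Adj⇒≢ pec (b , ut) ∷ [])
         ∷ (Adj⇒≢ pec (b , vw)
             ∷ (λ v≡t → a≢b (colour-unique pec uv (subst (λ z → col u z ≡ just b) (sym v≡t) ut)))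
             ∷ [])
         ∷ ((λ w≡t → t≢w (sym w≡t)) ∷ [])
         ∷ []
         ∷ []

module InvariantPartition {n k m : ℕ} {col : ColoredGraph n k}
    (pec : IsProperEdgeColoring col) (conn : Connected col) (acyclic : Acyclic col)
    (tr : ToggleRealization col m)
    {R : Fin n → Fin n → Set} (isEq : IsEquivalence R)
    (fixes : FixesPartition (InColoringGroup col) R) where

  open IsProperEdgeColoring pec
  open ToggleRealization tr using (φ; φ-inj; c)
  open Toggles pec tr
  open IsEquivalence isEq renaming (refl to R-refl; sym to R-sym; trans to R-trans)

  R-invariant : ∀ {g} → InColoringGroup col g → ∀ {x y} → R x y → R (g x) (g y)
  R-invariant {g} g∈G = fixes g g∈G _ _

  R-spread : ∀ {u v w} → Adj col u v → Adj col v w → R u v → R v w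
  R-spread {u} {v} {w} (a , uv) (b , vw) r with u ≟ᶠ w
  ... | yes refl = R-sym r
  ... | no u≢w   = R-trans (R-sym r) (subst₂ R τu≡u (τ-edge pec vw) (R-invariant (gmul b gid) r))
    where
    vu : col v u ≡ just a
    vu = trans (symmetric v u) uv
    τu≡u : τ col b u ≡ u
    τu≡u = τ-fixes-neighbour acyclic vu vw (λ { refl → u≢w (proper v u w a vu vw) })

  R-spread* : ∀ {u v z} → Walk col v z → Adj col u v → R u v → R v z
  R-spread* []        _  _ = R-refl
  R-spread* {v = v} (_∷_ {w = w} vw q) uv r = R-trans v~w (R-spread* q vw v~w)
    where
    v~w : R v w
    v~w = R-spread uv vw r

  adjacent-related⇒total : ∀ {u v} → Adj col u v → R u v → ∀ x y → R x y
  adjacent-related⇒total {v = v} uv r x y =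
    R-trans (R-sym (R-spread* (conn v x) uv r)) (R-spread* (conn v y) uv r)

  NoRelatedWalk : ℕ → Set
  NoRelatedWalk L = ∀ w → Chain col w L → w 0 ≢ w L → ¬ R (w 0) (w L)

  related-apart : ∀ {d} → (∀ {L} → L < d → NoRelatedWalk L) → ∀ {w s t} → Chain col w t →
                  s ≤ t → t < s + d → w s ≢ w t → ¬ R (w s) (w t)
  related-apart {d} shorter {w} {s} {t} chain s≤t t<s+d ws≢wt r =
    shorter t∸s<d (λ j → w (j + s)) (chain-segment col chain s≤t)
            (λ eq → ws≢wt (trans eq end)) (subst (R (w s)) (sym end) r)
    where
    end : w (t ∸ s + s) ≡ w t
    end = cong w (m∸n+n≡m s≤t)
    t∸s<d : t ∸ s < d
    t∸s<d = subst (t ∸ s <_) (m+n∸m≡n s d) (∸-monoˡ-< t<s+d s≤t)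

  module Slide (e : ℕ) (shorter : ∀ {L} → L < 2 + e → NoRelatedWalk L)
               (p : ℕ → Fin n) (chain : Chain col p (2 + e))
               (p₀≢p₂₊ₑ : p 0 ≢ p (2 + e)) (p₀~p₂₊ₑ : R (p 0) (p (2 + e))) where

    d : ℕ
    d = 2 + e

    colour : ℕ → Fin k
    colour i = proj₁ (chain (i % d) (m%n<n i d))

    colour-at : ∀ i → col (p (i % d)) (p (suc (i % d))) ≡ just (colour i)
    colour-at i = proj₂ (chain (i % d) (m%n<n i d))

    colour-spec : ∀ {j} → j < d → col (p j) (p (suc j)) ≡ just (colour j)
    colour-spec {j} j<d = subst (λ i → col (p i) (p (suc i)) ≡ just (colour j))
                                (m<n⇒m%n≡m j<d) (colour-at j)

    colour-periodic : ∀ i → colour (i + d) ≡ colour i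
    colour-periodic i = colour-unique pec
      (subst (λ j → col (p j) (p (suc j)) ≡ just (colour (i + d))) ([m+n]%n≡m%n i d) (colour-at (i + d)))
      (colour-at i)

    slide : ℕ → Fin n → Fin n
    slide zero    = id
    slide (suc i) = τ col (colour i) ∘ slide i

    slide∈G : ∀ i → InColoringGroup col (slide i)
    slide∈G zero    = gid
    slide∈G (suc i) = gmul (colour i) (slide∈G i)

    slide-+d : ∀ i v → slide (i + d) v ≡ slide i (slide d v)
    slide-+d zero    v = refl
    slide-+d (suc i) v = cong₂ (τ col) (colour-periodic i) (slide-+d i v)

    w : ℕ → Fin n
    w i = slide i (p 0)

    w≡p : ∀ {i} → i ≤ d → w i ≡ p i
    w≡p {zero}  _   = refl
    w≡p {suc i} i<d = trans (cong (τ col (colour i)) (w≡p (<⇒≤ i<d))) (τ-edge pec (colour-spec i<d))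

    w-+d : ∀ i → w (i + d) ≡ slide i (p d)
    w-+d i = trans (slide-+d i (p 0)) (cong (slide i) (w≡p ≤-refl))

    pair-related : ∀ i → R (w i) (w (i + d))
    pair-related i = subst (R (w i)) (sym (w-+d i)) (R-invariant (slide∈G i) p₀~p₂₊ₑ)

    pair-distinct : ∀ i → w i ≢ w (i + d)
    pair-distinct i eq = p₀≢p₂₊ₑ (InColoringGroup⇒injective pec (slide∈G i) (trans eq (w-+d i)))

    Edges : ℕ → Set
    Edges N = ∀ j → j < N → col (w j) (w (suc j)) ≡ just (colour j)

    Edges⇒Chain : ∀ {N} → Edges N → Chain col w N
    Edges⇒Chain edges j j<N = colour j , edges j j<N

    Invariant : ℕ → Set
    Invariant i = Edges (i + d) × φ (w i) △ φ (w (i + d)) ≡ φ (p 0) △ φ (p d)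

    invariant-zero : Invariant 0
    invariant-zero = (λ j j<d → subst₂ (λ u v → col u v ≡ just (colour j))
                                       (sym (w≡p (<⇒≤ j<d))) (sym (w≡p j<d)) (colour-spec j<d))
                   , cong (λ v → φ (p 0) △ φ v) (w≡p ≤-refl)

    -- If the next letter fixed w (i + d), the pair (w (1 + i), w (i + d)) would be closer than d.
    invariant-suc : ∀ i → Invariant i → Invariant (suc i)
    invariant-suc i (edges , diff) = edges′ , trans (△-shift (φ-edge (edges i i<i+d)) far-φ) diff
      where
      i<i+d : i < i + d
      i<i+d = m<m+n i z<s
      far-edge : col (w (i + d)) (w (suc (i + d))) ≡ just (colour (i + d))
      far-edge with τ-cases pec (colour (i + d)) (w (i + d))
      ... | inj₁ moved = moved
      ... | inj₂ fixed = ⊥-elim (related-apart shorter (Edges⇒Chain edges) i<i+d ≤-refl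
                                   (λ eq → pair-distinct (suc i) (trans eq (sym fixed)))
                                   (subst (R (w (suc i))) fixed (pair-related (suc i))))
      far-φ : φ (w (i + d)) △ φ (w (suc (i + d))) ≡ ⁅ c (colour i) ⁆
      far-φ = trans (φ-edge far-edge) (cong (λ a → ⁅ c a ⁆) (colour-periodic i))
      edges′ : Edges (suc i + d)
      edges′ j j<1+i+d with m<1+n⇒m<n∨m≡n j<1+i+d
      ... | inj₁ j<i+d = edges j j<i+d
      ... | inj₂ refl  = far-edge

    invariant : ∀ i → Invariant i
    invariant zero    = invariant-zero
    invariant (suc i) = invariant-suc i (invariant i)

    walks : ∀ N → Chain col w N
    walks N j _ = colour j , proj₁ (invariant (suc j)) j (m≤m+n (suc j) d)

    closes : w (d + d) ≡ w 0
    closes = φ-inj (△-cancelˡ (φ (w d)) (begin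
      φ (w d) △ φ (w (d + d))  ≡⟨ proj₂ (invariant d) ⟩
      φ (p 0) △ φ (p d)        ≡⟨ proj₂ (invariant 0) ⟨
      φ (w 0) △ φ (w d)        ≡⟨ △-comm (φ (w 0)) (φ (w d)) ⟩
      φ (w d) △ φ (w 0)        ∎))
      where open ≡-Reasoning

    -- A repetition w s = w t would move one of the pairs (w i, w (i + d)) closer than d.
    no-repetition : ∀ {s t} → s < t → t < d + d → w s ≢ w t
    no-repetition {s} {t} s<t t<d+d ws≡wt with t ≤? s + d
    ... | yes t≤s+d = related-apart shorter (walks _) t≤s+d (+-monoˡ-< d s<t)
                        (λ eq → pair-distinct s (trans ws≡wt eq))
                        (subst (λ z → R z (w (s + d))) ws≡wt (pair-related s))
    ... | no  t≰s+d = related-apart shorter (walks _) s≤t∸d (≤-trans t∸d<d (m≤n+m d s))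
                        (λ eq → pair-distinct (t ∸ d) (trans (sym eq) (trans ws≡wt (sym end))))
                        (R-sym (subst (R (w (t ∸ d))) (trans end (sym ws≡wt)) (pair-related (t ∸ d))))
      where
      s+d<t : s + d < t
      s+d<t = ≰⇒> t≰s+d
      end : w (t ∸ d + d) ≡ w t
      end = cong w (m∸n+n≡m (≤-trans (m≤n+m d s) (<⇒≤ s+d<t)))
      s≤t∸d : s ≤ t ∸ d
      s≤t∸d = m+n≤o⇒m≤o∸n s (<⇒≤ s+d<t)
      t∸d<d : t ∸ d < d
      t∸d<d = m<n+o⇒m∸n<o t d t<d+d

    cycle : Σ ℕ (Cycle col)
    cycle = closed-chain⇒cycle col w 3≤d+d (walks (d + d)) closes no-repetition
      where
      3≤d+d : 3 ≤ d + d
      3≤d+d = s≤s (s≤s (≤-trans (s≤s z≤n) (m≤n+m d e)))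

  no-related-walk : ∀ {x₀ y₀} → ¬ R x₀ y₀ → ∀ L → NoRelatedWalk L
  no-related-walk x₀≁y₀ = <-rec NoRelatedWalk step
    where
    step : ∀ L → (∀ {L′} → L′ < L → NoRelatedWalk L′) → NoRelatedWalk L
    step zero          _       w _     w₀≢w₀ _ = w₀≢w₀ refl
    step (suc zero)    _       w chain _     r = x₀≁y₀ (adjacent-related⇒total (chain 0 z<s) r _ _)
    step (suc (suc e)) shorter w chain w₀≢wₗ r = uncurry acyclic (Slide.cycle e shorter w chain w₀≢wₗ r)

  distinct⇒unrelated : ∀ {x₀ y₀} → ¬ R x₀ y₀ → ∀ {x y} → x ≢ y → ¬ R x y
  distinct⇒unrelated x₀≁y₀ {x} {y} x≢y with walk⇒chain col (conn x y)
  ... | N , w , refl , refl , chain = no-related-walk x₀≁y₀ N w chain x≢y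

theorem4p4 : (n k : ℕ) → 3 ≤ n → (col : ColoredGraph n k) →
    IsProperEdgeColoring col → IsTree col →
    IsGeneralizedToggleGroup col →
    IsPrimitive (InColoringGroup col)
theorem4p4 n k _ col pec (conn , acyclic) (m , tr) (R , isEq , fixes , (x , y , x≢y , x~y) , (_ , _ , x₀≁y₀)) =
  InvariantPartition.distinct⇒unrelated pec conn acyclic tr isEq fixes x₀≁y₀ x≢y x~y
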